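{- Let $\mathcal{R}$ be a set of rewrite rules. If $\to_{\mathcal{R}}$ is locally confluent on algebraic terms (i.e. whenever an algebraic term $t$ satisfies $t\to_{\mathcal{R}}u$ and $t\to_{\mathcal{R}}v$, there is $w$ with $u\to_{\mathcal{R}}^* w$ and $v\to_{\mathcal{R}}^* w$), then the relation $\to\;=\;\to_\beta\cup\to_{\mathcal{R}}$ is locally confluent on all terms: whenever $t\to u$ and $t\to v$, there exists $w$ with $u\to^* w$ and $v\to^* w$.
   Context: Terms: fix two sorts $\star$ and $\Box$, an infinite countable set $\mathcal{X}$ of variables and a countable set $\mathcal{F}$ of symbols (disjoint from each other and from the sorts). Terms are given by $t ::= s \mid x \mid f \mid [x:t]t \mid (x:t)t \mid t\,t$ with $s$ a sort, $x\in\mathcal{X}$, $f\in\mathcal{F}$ ($[x:T]u$ is abstraction, $(x:T)U$ dependent product, $t\,u$ application), taken up to $\alpha$-equivalence; $\mathrm{FV}(t)$ denotes the free variables and $t\{x\mapsto u\}$ capture-avoiding substitution. $\beta$-reduction $\to_\beta$ is the smallest relation stable by context and substitution containing $[x:U]v\,u\to v\{x\mapsto u\}$. A term is algebraic if it is built only from variables and applications $f\,t_1\ldots t_n$ with $f\in\mathcal{F}$ and $t_i$ algebraic. A rewrite rule is a pair $l\to r$ of terms with $l$ algebraic, $l$ not a variable, and $\mathrm{FV}(r)\subseteq\mathrm{FV}(l)$. For a set $\mathcal{R}$ of rules, $\to_{\mathcal{R}}$ is the smallest relation containing $\mathcal{R}$ and stable by substitution and by context. $\to^*$ denotes reflexive–transitive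 closure. -}

module Defs where

open import Data.Nat using (ℕ; zero; suc)
open import Data.Product using (Σ; _×_; ∃)
open import Data.Empty using (⊥)
open import Data.Unit using (⊤)
open import Relation.Nullary using (¬_)
open import Function.Definitions using (Injective)
open import Relation.Binary.PropositionalEquality using (_≡_)
open import Relation.Binary.Construct.Closure.ReflexiveTransitive using (Star)

data Sort : Set where
  ⋆ □ : Sort

-- Terms over a set F of symbols, with variables as de Bruijn indices
-- (so terms are identified up to α-equivalence by construction).
--   lam T u  is  [x:T]u   (x bound in u only)
--   pi  T U  is  (x:T)U   (x bound in U only)
--   app t u  is  t u
data Term (F : Set) : Set where
  sort : Sort → Term F
  var  : ℕ → Term F
  fun  : F → Term F
  lam  : Term F → Term F → Term F
  pi   : Term F → Term F → Term F
  app  : Term F → Term F → Term F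

module _ {F : Set} where

  extR : (ℕ → ℕ) → ℕ → ℕ
  extR ρ zero    = zero
  extR ρ (suc n) = suc (ρ n)

  ren : (ℕ → ℕ) → Term F → Term F
  ren ρ (sort s)  = sort s
  ren ρ (var x)   = var (ρ x)
  ren ρ (fun f)   = fun f
  ren ρ (lam T u) = lam (ren ρ T) (ren (extR ρ) u)
  ren ρ (pi T U)  = pi (ren ρ T) (ren (extR ρ) U)
  ren ρ (app t u) = app (ren ρ t) (ren ρ u)

  extS : (ℕ → Term F) → ℕ → Term F
  extS σ zero    = var zero
  extS σ (suc n) = ren suc (σ n)

  sub : (ℕ → Term F) → Term F → Term F
  sub σ (sort s)  = sort s
  sub σ (var x)   = σ x
  sub σ (fun f)   = fun f
  sub σ (lam T u) = lam (sub σ T) (sub (extS σ) u)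
  sub σ (pi T U)  = pi (sub σ T) (sub (extS σ) U)
  sub σ (app t u) = app (sub σ t) (sub σ u)

  -- v{x ↦ u} where x is the variable bound by the outermost binder of v
  single : Term F → ℕ → Term F
  single u zero    = u
  single u (suc n) = var n

  _[_] : Term F → Term F → Term F
  v [ u ] = sub (single u) v

  data _∈FV_ : ℕ → Term F → Set where
    fv-var  : ∀ {x} → x ∈FV var x
    fv-lam₁ : ∀ {x T u} → x ∈FV T → x ∈FV lam T u
    fv-lam₂ : ∀ {x T u} → suc x ∈FV u → x ∈FV lam T u
    fv-pi₁  : ∀ {x T U} → x ∈FV T → x ∈FV pi T U
    fv-pi₂  : ∀ {x T U} → suc x ∈FV U → x ∈FV pi T U
    fv-app₁ : ∀ {x t u} → x ∈FV t → x ∈FV app t u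
    fv-app₂ : ∀ {x t u} → x ∈FV u → x ∈FV app t u

  mutual
    data AlgApp : Term F → Set where
      alg-fun : ∀ f → AlgApp (fun f)
      alg-app : ∀ {t u} → AlgApp t → Algebraic u → AlgApp (app t u)

    data Algebraic : Term F → Set where
      alg-var  : ∀ x → Algebraic (var x)
      alg-head : ∀ {t} → AlgApp t → Algebraic t

  IsVar : Term F → Set
  IsVar (var x) = ⊤
  IsVar _       = ⊥

  RuleSet : Set₁
  RuleSet = Term F → Term F → Set

  WellFormedRules : RuleSet → Set
  WellFormedRules ℛ = ∀ {l r} → ℛ l r →
    Algebraic l × (¬ IsVar l) × (∀ x → x ∈FV r → x ∈FV l)

  data Ctx (S : Term F → Term F → Set) : Term F → Term F → Set where
    root  : ∀ {t u} → S t u → Ctx S t u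
    lam₁  : ∀ {T T' u} → Ctx S T T' → Ctx S (lam T u) (lam T' u)
    lam₂  : ∀ {T u u'} → Ctx S u u' → Ctx S (lam T u) (lam T u')
    pi₁   : ∀ {T T' U} → Ctx S T T' → Ctx S (pi T U) (pi T' U)
    pi₂   : ∀ {T U U'} → Ctx S U U' → Ctx S (pi T U) (pi T U')
    app₁  : ∀ {t t' u} → Ctx S t t' → Ctx S (app t u) (app t' u)
    app₂  : ∀ {t u u'} → Ctx S u u' → Ctx S (app t u) (app t u')

  -- root β-steps (all instances; already closed under substitution)
  data BetaRoot : Term F → Term F → Set where
    beta : ∀ T v u → BetaRoot (app (lam T v) u) (v [ u ])

  data RRoot (ℛ : RuleSet) : Term F → Term F → Set where
    inst : ∀ {l r} (σ : ℕ → Term F) → ℛ l r → RRoot ℛ (sub σ l) (sub σ r)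

  _→β_ : Term F → Term F → Set
  _→β_ = Ctx BetaRoot

  _⟶[_]_ : Term F → RuleSet → Term F → Set
  t ⟶[ ℛ ] u = Ctx (RRoot ℛ) t u

  data Step (ℛ : RuleSet) (t u : Term F) : Set where
    βstep : t →β u → Step ℛ t u
    Rstep : t ⟶[ ℛ ] u → Step ℛ t u

  LocallyConfluentOn : (Term F → Set) → (Term F → Term F → Set) → Set
  LocallyConfluentOn P _⇒_ = ∀ {t u v} → P t → t ⇒ u → t ⇒ v →
    ∃ λ w → Star _⇒_ u w × Star _⇒_ v w

  LocallyConfluent : (Term F → Term F → Set) → Set
  LocallyConfluent _⇒_ = ∀ {t u v} → t ⇒ u → t ⇒ v →
    ∃ λ w → Star _⇒_ u w × Star _⇒_ v w

Countable : Set → Set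
Countable A = Σ (A → ℕ) Injective′
  where Injective′ : (A → ℕ) → Set
        Injective′ g = Injective _≡_ _≡_ g

module Submission where

-- A β-redex is headed by an abstraction while an instance of a left-hand side is headed by a
-- symbol, so in a peak made of a β-step and a rule step one step happens inside a subterm that
-- the other merely copies or substitutes, and the peak is joined by reducing every copy of that
-- subterm (rules may be non-linear).  For a rule step at the root and another rule step, replace
-- the aliens of the term (its maximal subterms not headed by a symbol) by variables, equal
-- aliens by equal variables; equality is decidable because the symbols are countable.  The
-- resulting cap is algebraic and the root step lifts to it.  Either the other step lifts as
-- well, and local confluence on algebraic terms joins the lifted peak, or it happens inside an
-- alien and is joined as before.

open import Defs
open import Data.Empty using (⊥-elim)
open import Data.Unit using (tt)
open import Data.List using (List; []; _∷_; _++_; length)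
open import Data.List.Membership.Propositional using (_∈_)
open import Data.List.Relation.Binary.Subset.Propositional using (_⊆_)
open import Data.List.Relation.Binary.Subset.Propositional.Properties using (xs⊆xs++ys; xs⊆ys++xs)
open import Data.List.Relation.Unary.Any using (here; there)
open import Data.Nat using (ℕ; zero; suc; _+_)
import Data.Nat as ℕ
open import Data.Nat.Properties using (eq?)
open import Data.Product using (∃; _×_; _,_; proj₁; proj₂; map₂; swap; uncurry)
open import Data.Sum using (inj₁; inj₂; [_,_]′)
import Data.Sum as Sum
open import Function using (_∘_; id; mk↣)
open import Relation.Binary.Core using (_⇒_; _⇔_; _=[_]⇒_)
open import Relation.Binary.Definitions using (DecidableEquality)
open import Relation.Binary.Construct.Union using (_∪_)
open import Relation.Binary.Construct.Closure.ReflexiveTransitive using (Star; ε; _◅_; _◅◅_; gmap)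
import Relation.Binary.Construct.Closure.ReflexiveTransitive as Star
open import Relation.Binary.PropositionalEquality
  using (_≡_; refl; sym; trans; cong; cong₂; subst; subst₂; _≗_; module ≡-Reasoning)
open import Relation.Nullary using (Dec; yes; no; contradiction)
open import Relation.Nullary.Decidable using (map′; _×-dec_)

module _ {F : Set} where

  Subst : Set
  Subst = ℕ → Term F

  extR-cong : ∀ {ρ ρ′ : ℕ → ℕ} → ρ ≗ ρ′ → extR {F} ρ ≗ extR {F} ρ′
  extR-cong h zero    = refl
  extR-cong h (suc x) = cong suc (h x)

  ren-cong : ∀ {ρ ρ′ : ℕ → ℕ} → ρ ≗ ρ′ → ren {F} ρ ≗ ren ρ′
  ren-cong h (sort s)  = refl
  ren-cong h (var x)   = cong var (h x)
  ren-cong h (fun f)   = refl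
  ren-cong h (lam T u) = cong₂ lam (ren-cong h T) (ren-cong (extR-cong h) u)
  ren-cong h (pi T U)  = cong₂ pi (ren-cong h T) (ren-cong (extR-cong h) U)
  ren-cong h (app t u) = cong₂ app (ren-cong h t) (ren-cong h u)

  sub-cong-FV : ∀ {σ τ : Subst} t → (∀ x → x ∈FV t → σ x ≡ τ x) → sub σ t ≡ sub τ t
  sub-cong-FV (sort s)  h = refl
  sub-cong-FV (var x)   h = h x fv-var
  sub-cong-FV (fun f)   h = refl
  sub-cong-FV (lam T u) h = cong₂ lam (sub-cong-FV T (λ x → h x ∘ fv-lam₁))
    (sub-cong-FV u λ { zero _ → refl ; (suc x) p → cong (ren suc) (h x (fv-lam₂ p)) })
  sub-cong-FV (pi T U)  h = cong₂ pi (sub-cong-FV T (λ x → h x ∘ fv-pi₁))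
    (sub-cong-FV U λ { zero _ → refl ; (suc x) p → cong (ren suc) (h x (fv-pi₂ p)) })
  sub-cong-FV (app t u) h =
    cong₂ app (sub-cong-FV t (λ x → h x ∘ fv-app₁)) (sub-cong-FV u (λ x → h x ∘ fv-app₂))

  sub-cong : ∀ {σ τ : Subst} → σ ≗ τ → sub σ ≗ sub τ
  sub-cong h t = sub-cong-FV t (λ x _ → h x)

  ren-ren : ∀ (ρ ρ′ : ℕ → ℕ) (t : Term F) → ren ρ (ren ρ′ t) ≡ ren (ρ ∘ ρ′) t
  ren-ren ρ ρ′ (sort s)  = refl
  ren-ren ρ ρ′ (var x)   = refl
  ren-ren ρ ρ′ (fun f)   = refl
  ren-ren ρ ρ′ (lam T u) = cong₂ lam (ren-ren ρ ρ′ T)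
    (trans (ren-ren (extR {F} ρ) (extR {F} ρ′) u) (ren-cong (λ { zero → refl ; (suc x) → refl }) u))
  ren-ren ρ ρ′ (pi T U)  = cong₂ pi (ren-ren ρ ρ′ T)
    (trans (ren-ren (extR {F} ρ) (extR {F} ρ′) U) (ren-cong (λ { zero → refl ; (suc x) → refl }) U))
  ren-ren ρ ρ′ (app t u) = cong₂ app (ren-ren ρ ρ′ t) (ren-ren ρ ρ′ u)

  extS-ren : ∀ (ρ : ℕ → ℕ) (σ : Subst) → ren (extR {F} ρ) ∘ extS σ ≗ extS (ren ρ ∘ σ)
  extS-ren ρ σ zero    = refl
  extS-ren ρ σ (suc x) = trans (ren-ren (extR {F} ρ) suc (σ x)) (sym (ren-ren suc ρ (σ x)))

  ren-sub : ∀ (ρ : ℕ → ℕ) (σ : Subst) t → ren ρ (sub σ t) ≡ sub (ren ρ ∘ σ) t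
  ren-sub ρ σ (sort s)  = refl
  ren-sub ρ σ (var x)   = refl
  ren-sub ρ σ (fun f)   = refl
  ren-sub ρ σ (lam T u) = cong₂ lam (ren-sub ρ σ T)
    (trans (ren-sub (extR {F} ρ) (extS σ) u) (sub-cong (extS-ren ρ σ) u))
  ren-sub ρ σ (pi T U)  = cong₂ pi (ren-sub ρ σ T)
    (trans (ren-sub (extR {F} ρ) (extS σ) U) (sub-cong (extS-ren ρ σ) U))
  ren-sub ρ σ (app t u) = cong₂ app (ren-sub ρ σ t) (ren-sub ρ σ u)

  sub-ren : ∀ (σ : Subst) (ρ : ℕ → ℕ) t → sub σ (ren ρ t) ≡ sub (σ ∘ ρ) t
  sub-ren σ ρ (sort s)  = refl
  sub-ren σ ρ (var x)   = refl
  sub-ren σ ρ (fun f)   = refl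
  sub-ren σ ρ (lam T u) = cong₂ lam (sub-ren σ ρ T)
    (trans (sub-ren (extS σ) (extR {F} ρ) u) (sub-cong (λ { zero → refl ; (suc x) → refl }) u))
  sub-ren σ ρ (pi T U)  = cong₂ pi (sub-ren σ ρ T)
    (trans (sub-ren (extS σ) (extR {F} ρ) U) (sub-cong (λ { zero → refl ; (suc x) → refl }) U))
  sub-ren σ ρ (app t u) = cong₂ app (sub-ren σ ρ t) (sub-ren σ ρ u)

  extS-sub : ∀ (σ τ : Subst) → sub (extS σ) ∘ extS τ ≗ extS (sub σ ∘ τ)
  extS-sub σ τ zero    = refl
  extS-sub σ τ (suc x) = trans (sub-ren (extS σ) suc (τ x)) (sym (ren-sub suc σ (τ x)))

  sub-sub : ∀ (σ τ : Subst) t → sub σ (sub τ t) ≡ sub (sub σ ∘ τ) t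
  sub-sub σ τ (sort s)  = refl
  sub-sub σ τ (var x)   = refl
  sub-sub σ τ (fun f)   = refl
  sub-sub σ τ (lam T u) = cong₂ lam (sub-sub σ τ T)
    (trans (sub-sub (extS σ) (extS τ) u) (sub-cong (extS-sub σ τ) u))
  sub-sub σ τ (pi T U)  = cong₂ pi (sub-sub σ τ T)
    (trans (sub-sub (extS σ) (extS τ) U) (sub-cong (extS-sub σ τ) U))
  sub-sub σ τ (app t u) = cong₂ app (sub-sub σ τ t) (sub-sub σ τ u)

  sub-var : ∀ (t : Term F) → sub var t ≡ t
  sub-var (sort s)  = refl
  sub-var (var x)   = refl
  sub-var (fun f)   = refl
  sub-var (lam T u) = cong₂ lam (sub-var T)
    (trans (sub-cong (λ { zero → refl ; (suc x) → refl }) u) (sub-var u))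
  sub-var (pi T U)  = cong₂ pi (sub-var T)
    (trans (sub-cong (λ { zero → refl ; (suc x) → refl }) U) (sub-var U))
  sub-var (app t u) = cong₂ app (sub-var t) (sub-var u)

  ren-as-sub : ∀ (ρ : ℕ → ℕ) (t : Term F) → ren ρ t ≡ sub (var ∘ ρ) t
  ren-as-sub ρ (sort s)  = refl
  ren-as-sub ρ (var x)   = refl
  ren-as-sub ρ (fun f)   = refl
  ren-as-sub ρ (lam T u) = cong₂ lam (ren-as-sub ρ T)
    (trans (ren-as-sub (extR {F} ρ) u) (sub-cong (λ { zero → refl ; (suc x) → refl }) u))
  ren-as-sub ρ (pi T U)  = cong₂ pi (ren-as-sub ρ T)
    (trans (ren-as-sub (extR {F} ρ) U) (sub-cong (λ { zero → refl ; (suc x) → refl }) U))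
  ren-as-sub ρ (app t u) = cong₂ app (ren-as-sub ρ t) (ren-as-sub ρ u)

  sub-[] : ∀ (σ : Subst) v w → sub σ (v [ w ]) ≡ sub (extS σ) v [ sub σ w ]
  sub-[] σ v w = begin
    sub σ (sub (single w) v)                        ≡⟨ sub-sub σ (single w) v ⟩
    sub (sub σ ∘ single w) v                        ≡⟨ sub-cong single-extS v ⟩
    sub (sub (single (sub σ w)) ∘ extS σ) v         ≡⟨ sym (sub-sub _ (extS σ) v) ⟩
    sub (single (sub σ w)) (sub (extS σ) v)         ∎
    where
    open ≡-Reasoning
    single-extS : sub σ ∘ single w ≗ sub (single (sub σ w)) ∘ extS σ
    single-extS zero    = refl
    single-extS (suc x) = sym (trans (sub-ren (single (sub σ w)) suc (σ x)) (sub-var (σ x)))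

  BetaRoot-sub : ∀ (σ : Subst) → BetaRoot =[ sub σ ]⇒ BetaRoot
  BetaRoot-sub σ (beta T v w) =
    subst (BetaRoot _) (sym (sub-[] σ v w)) (beta (sub σ T) (sub (extS σ) v) (sub σ w))

  RRoot-sub : ∀ {ℛ : RuleSet} (σ : Subst) → RRoot ℛ =[ sub σ ]⇒ RRoot ℛ
  RRoot-sub {ℛ} σ (inst {l} {r} τ l→r) =
    subst₂ (RRoot ℛ) (sym (sub-sub σ τ l)) (sym (sub-sub σ τ r)) (inst (sub σ ∘ τ) l→r)

  Joinable : (Term F → Term F → Set) → Term F → Term F → Set
  Joinable _⇒_ u v = ∃ λ w → Star _⇒_ u w × Star _⇒_ v w

  module _ {R : Term F → Term F → Set} where

    Joinable-map : ∀ (f : Term F → Term F) → R =[ f ]⇒ R → Joinable R =[ f ]⇒ Joinable R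
    Joinable-map f f-mono (w , p , q) = f w , gmap f f-mono p , gmap f f-mono q

    locallyConfluent-⇔ : ∀ {R′} → R ⇔ R′ → LocallyConfluent R → LocallyConfluent R′
    locallyConfluent-⇔ (to , from) lc s s′ =
      let w , p , q = lc (from s) (from s′) in w , Star.map to p , Star.map to q

  module _ {S T : Term F → Term F → Set} where

    Ctx-map : S ⇒ T → Ctx S ⇒ Ctx T
    Ctx-map f (root s) = root (f s)
    Ctx-map f (lam₁ s) = lam₁ (Ctx-map f s)
    Ctx-map f (lam₂ s) = lam₂ (Ctx-map f s)
    Ctx-map f (pi₁ s)  = pi₁ (Ctx-map f s)
    Ctx-map f (pi₂ s)  = pi₂ (Ctx-map f s)
    Ctx-map f (app₁ s) = app₁ (Ctx-map f s)
    Ctx-map f (app₂ s) = app₂ (Ctx-map f s)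

    Ctx-∪ : Ctx (S ∪ T) ⇒ Ctx S ∪ Ctx T
    Ctx-∪ (root (inj₁ s)) = inj₁ (root s)
    Ctx-∪ (root (inj₂ s)) = inj₂ (root s)
    Ctx-∪ (lam₁ s) = Sum.map lam₁ lam₁ (Ctx-∪ s)
    Ctx-∪ (lam₂ s) = Sum.map lam₂ lam₂ (Ctx-∪ s)
    Ctx-∪ (pi₁ s)  = Sum.map pi₁ pi₁ (Ctx-∪ s)
    Ctx-∪ (pi₂ s)  = Sum.map pi₂ pi₂ (Ctx-∪ s)
    Ctx-∪ (app₁ s) = Sum.map app₁ app₁ (Ctx-∪ s)
    Ctx-∪ (app₂ s) = Sum.map app₂ app₂ (Ctx-∪ s)

  module _ {S : Term F → Term F → Set} where

    Ctx-sub : (∀ σ → S =[ sub σ ]⇒ S) → ∀ σ → Ctx S =[ sub σ ]⇒ Ctx S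
    Ctx-sub S-sub σ (root s) = root (S-sub σ s)
    Ctx-sub S-sub σ (lam₁ s) = lam₁ (Ctx-sub S-sub σ s)
    Ctx-sub S-sub σ (lam₂ s) = lam₂ (Ctx-sub S-sub (extS σ) s)
    Ctx-sub S-sub σ (pi₁ s)  = pi₁ (Ctx-sub S-sub σ s)
    Ctx-sub S-sub σ (pi₂ s)  = pi₂ (Ctx-sub S-sub (extS σ) s)
    Ctx-sub S-sub σ (app₁ s) = app₁ (Ctx-sub S-sub σ s)
    Ctx-sub S-sub σ (app₂ s) = app₂ (Ctx-sub S-sub σ s)

    Ctx-locallyConfluent : (∀ {t u v} → S t u → Ctx S t v → Joinable (Ctx S) u v) →
                           LocallyConfluent (Ctx S)
    Ctx-locallyConfluent root-peak = peak
      where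
      peak : LocallyConfluent (Ctx S)
      peak (root s) s′        = root-peak s s′
      peak s (root s′)        = map₂ swap (root-peak s′ s)
      peak (lam₁ s) (lam₁ s′) = Joinable-map (λ T → lam T _) lam₁ (peak s s′)
      peak (lam₁ s) (lam₂ s′) = _ , lam₂ s′ ◅ ε , lam₁ s ◅ ε
      peak (lam₂ s) (lam₁ s′) = _ , lam₁ s′ ◅ ε , lam₂ s ◅ ε
      peak (lam₂ s) (lam₂ s′) = Joinable-map (lam _) lam₂ (peak s s′)
      peak (pi₁ s) (pi₁ s′)   = Joinable-map (λ T → pi T _) pi₁ (peak s s′)
      peak (pi₁ s) (pi₂ s′)   = _ , pi₂ s′ ◅ ε , pi₁ s ◅ ε
      peak (pi₂ s) (pi₁ s′)   = _ , pi₁ s′ ◅ ε , pi₂ s ◅ ε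
      peak (pi₂ s) (pi₂ s′)   = Joinable-map (pi _) pi₂ (peak s s′)
      peak (app₁ s) (app₁ s′) = Joinable-map (λ t → app t _) app₁ (peak s s′)
      peak (app₁ s) (app₂ s′) = _ , app₂ s′ ◅ ε , app₁ s ◅ ε
      peak (app₂ s) (app₁ s′) = _ , app₁ s′ ◅ ε , app₂ s ◅ ε
      peak (app₂ s) (app₂ s′) = Joinable-map (app _) app₂ (peak s s′)

  app-injectiveˡ : ∀ {t t′ u u′ : Term F} → app t u ≡ app t′ u′ → t ≡ t′
  app-injectiveˡ refl = refl

  app-injectiveʳ : ∀ {t t′ u u′ : Term F} → app t u ≡ app t′ u′ → u ≡ u′
  app-injectiveʳ refl = refl

  data FunHeaded : Term F → Set where
    fun : ∀ f → FunHeaded (fun f)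
    app : ∀ {t u} → FunHeaded t → FunHeaded (app t u)

  funHeaded? : ∀ t → Dec (FunHeaded t)
  funHeaded? (sort s)  = no λ ()
  funHeaded? (var x)   = no λ ()
  funHeaded? (fun f)   = yes (fun f)
  funHeaded? (lam T u) = no λ ()
  funHeaded? (pi T U)  = no λ ()
  funHeaded? (app t u) = map′ app (λ { (app h) → h }) (funHeaded? t)

  AlgApp-FunHeaded : ∀ {l} → AlgApp l → ∀ σ → FunHeaded (sub σ l)
  AlgApp-FunHeaded (alg-fun f)   σ = fun f
  AlgApp-FunHeaded (alg-app l m) σ = app (AlgApp-FunHeaded l σ)

  mutual
    sub-agree-on-FV : ∀ {σ τ : Subst} {l x} → Algebraic l → sub σ l ≡ sub τ l → x ∈FV l → σ x ≡ τ x
    sub-agree-on-FV (alg-var x)  e fv-var = e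
    sub-agree-on-FV (alg-head l) e x∈l    = AlgApp-agree-on-FV l e x∈l

    AlgApp-agree-on-FV : ∀ {σ τ : Subst} {l x} → AlgApp l → sub σ l ≡ sub τ l → x ∈FV l → σ x ≡ τ x
    AlgApp-agree-on-FV (alg-app l m) e (fv-app₁ x∈l) = AlgApp-agree-on-FV l (app-injectiveˡ e) x∈l
    AlgApp-agree-on-FV (alg-app l m) e (fv-app₂ x∈m) = sub-agree-on-FV m (app-injectiveʳ e) x∈m

  data MixedInstance (σ σ′ : Subst) : Term F → Term F → Set where
    left  : ∀ {x v} → σ x ≡ v → MixedInstance σ σ′ (var x) v
    right : ∀ {x v} → σ′ x ≡ v → MixedInstance σ σ′ (var x) v
    fun   : ∀ f → MixedInstance σ σ′ (fun f) (fun f)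
    app   : ∀ {a b c d} → MixedInstance σ σ′ a b → MixedInstance σ σ′ c d →
            MixedInstance σ σ′ (app a c) (app b d)

  mutual
    mixed-refl : ∀ {σ σ′ a} → Algebraic a → MixedInstance σ σ′ a (sub σ a)
    mixed-refl (alg-var x)  = left refl
    mixed-refl (alg-head a) = AlgApp-mixed-refl a

    AlgApp-mixed-refl : ∀ {σ σ′ a} → AlgApp a → MixedInstance σ σ′ a (sub σ a)
    AlgApp-mixed-refl (alg-fun f)   = fun f
    AlgApp-mixed-refl (alg-app a b) = app (AlgApp-mixed-refl a) (mixed-refl b)

  update : Subst → ℕ → Term F → Subst
  update σ k s j with j ℕ.≟ k
  ... | yes _ = s
  ... | no _  = σ j

  update-same : ∀ σ k s → update σ k s k ≡ s
  update-same σ k s with k ℕ.≟ k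
  ... | yes _  = refl
  ... | no k≢k = contradiction refl k≢k

module Capping {F : Set} (_≟ᶠ_ : DecidableEquality F) where

  _≟ˢ_ : DecidableEquality Sort
  ⋆ ≟ˢ ⋆ = yes refl
  ⋆ ≟ˢ □ = no λ ()
  □ ≟ˢ ⋆ = no λ ()
  □ ≟ˢ □ = yes refl

  _≟_ : DecidableEquality (Term F)
  sort s  ≟ sort s′   = map′ (cong sort) (λ { refl → refl }) (s ≟ˢ s′)
  var x   ≟ var x′    = map′ (cong var) (λ { refl → refl }) (x ℕ.≟ x′)
  fun f   ≟ fun f′    = map′ (cong fun) (λ { refl → refl }) (f ≟ᶠ f′)
  lam T u ≟ lam T′ u′ = map′ (uncurry (cong₂ lam)) (λ { refl → refl , refl }) (T ≟ T′ ×-dec u ≟ u′)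
  pi T U  ≟ pi T′ U′  = map′ (uncurry (cong₂ pi)) (λ { refl → refl , refl }) (T ≟ T′ ×-dec U ≟ U′)
  app t u ≟ app t′ u′ = map′ (uncurry (cong₂ app)) (λ { refl → refl , refl }) (t ≟ t′ ×-dec u ≟ u′)
  sort _  ≟ var _     = no λ ()
  sort _  ≟ fun _     = no λ ()
  sort _  ≟ lam _ _   = no λ ()
  sort _  ≟ pi _ _    = no λ ()
  sort _  ≟ app _ _   = no λ ()
  var _   ≟ sort _    = no λ ()
  var _   ≟ fun _     = no λ ()
  var _   ≟ lam _ _   = no λ ()
  var _   ≟ pi _ _    = no λ ()
  var _   ≟ app _ _   = no λ ()
  fun _   ≟ sort _    = no λ ()
  fun _   ≟ var _     = no λ ()
  fun _   ≟ lam _ _   = no λ ()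
  fun _   ≟ pi _ _    = no λ ()
  fun _   ≟ app _ _   = no λ ()
  lam _ _ ≟ sort _    = no λ ()
  lam _ _ ≟ var _     = no λ ()
  lam _ _ ≟ fun _     = no λ ()
  lam _ _ ≟ pi _ _    = no λ ()
  lam _ _ ≟ app _ _   = no λ ()
  pi _ _  ≟ sort _    = no λ ()
  pi _ _  ≟ var _     = no λ ()
  pi _ _  ≟ fun _     = no λ ()
  pi _ _  ≟ lam _ _   = no λ ()
  pi _ _  ≟ app _ _   = no λ ()
  app _ _ ≟ sort _    = no λ ()
  app _ _ ≟ var _     = no λ ()
  app _ _ ≟ fun _     = no λ ()
  app _ _ ≟ lam _ _   = no λ ()
  app _ _ ≟ pi _ _    = no λ ()

  aliens : Term F → List (Term F)
  aliens (var x)   = []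
  aliens (fun f)   = []
  aliens (app t u) with funHeaded? t
  ... | yes _ = aliens t ++ aliens u
  ... | no _  = app t u ∷ []
  aliens t = t ∷ []

  index : List (Term F) → Term F → ℕ
  index []      a = zero
  index (b ∷ L) a with a ≟ b
  ... | yes _ = zero
  ... | no _  = suc (index L a)

  -- Variables below length L name the aliens listed in L; those above are shifted free variables.
  restore : List (Term F) → Subst
  restore []      x       = var x
  restore (a ∷ L) zero    = a
  restore (a ∷ L) (suc x) = restore L x

  restore-index : ∀ {a L} → a ∈ L → restore L (index L a) ≡ a
  restore-index {a} {b ∷ L} a∈L with a ≟ b
  restore-index (here _)    | yes a≡b = sym a≡b
  restore-index (there _)   | yes a≡b = sym a≡b
  restore-index (here a≡b)  | no a≢b  = contradiction a≡b a≢b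
  restore-index (there a∈L) | no _    = restore-index a∈L

  restore-shift : ∀ L x → restore L (length L + x) ≡ var x
  restore-shift []      x = refl
  restore-shift (a ∷ L) x = restore-shift L x

  cap : List (Term F) → Term F → Term F
  cap L (var x)   = var (length L + x)
  cap L (fun f)   = fun f
  cap L (app t u) with funHeaded? t
  ... | yes _ = app (cap L t) (cap L u)
  ... | no _  = var (index L (app t u))
  cap L t = var (index L t)

  restore-cap : ∀ {L} t → aliens t ⊆ L → sub (restore L) (cap L t) ≡ t
  restore-cap (sort s)  ⊆L = restore-index (⊆L (here refl))
  restore-cap {L} (var x) ⊆L = restore-shift L x
  restore-cap (fun f)   ⊆L = refl
  restore-cap (lam T u) ⊆L = restore-index (⊆L (here refl))
  restore-cap (pi T U)  ⊆L = restore-index (⊆L (here refl))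
  restore-cap (app t u) ⊆L with funHeaded? t
  ... | yes _ = cong₂ app (restore-cap t (⊆L ∘ xs⊆xs++ys _ _)) (restore-cap u (⊆L ∘ xs⊆ys++xs _ _))
  ... | no _  = restore-index (⊆L (here refl))

  mutual
    cap-algebraic : ∀ L t → Algebraic (cap L t)
    cap-algebraic L (sort s)  = alg-var _
    cap-algebraic L (var x)   = alg-var _
    cap-algebraic L (fun f)   = alg-head (alg-fun f)
    cap-algebraic L (lam T u) = alg-var _
    cap-algebraic L (pi T U)  = alg-var _
    cap-algebraic L (app t u) with funHeaded? t
    ... | yes t-head = alg-head (alg-app (cap-AlgApp L t-head) (cap-algebraic L u))
    ... | no _       = alg-var _

    cap-AlgApp : ∀ L {t} → FunHeaded t → AlgApp (cap L t)
    cap-AlgApp L (fun f) = alg-fun f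
    cap-AlgApp L {app t u} (app t-head) with funHeaded? t
    ... | yes _        = alg-app (cap-AlgApp L t-head) (cap-algebraic L u)
    ... | no ¬t-head   = contradiction t-head ¬t-head

  mutual
    cap-sub : ∀ L σ {l} → Algebraic l → cap L (sub σ l) ≡ sub (cap L ∘ σ) l
    cap-sub L σ (alg-var x)  = refl
    cap-sub L σ (alg-head l) = AlgApp-cap-sub L σ l

    AlgApp-cap-sub : ∀ L σ {l} → AlgApp l → cap L (sub σ l) ≡ sub (cap L ∘ σ) l
    AlgApp-cap-sub L σ (alg-fun f) = refl
    AlgApp-cap-sub L σ (alg-app {l} l-app m) with funHeaded? (sub σ l)
    ... | yes _      = cong₂ app (AlgApp-cap-sub L σ l-app) (cap-sub L σ m)
    ... | no ¬l-head = contradiction (AlgApp-FunHeaded l-app σ) ¬l-head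

module _ {F : Set} (ℛ : RuleSet {F}) where

  infix 4 _⟶_ _⟶*_

  _⟶_ : Term F → Term F → Set
  _⟶_ = Ctx (BetaRoot ∪ RRoot ℛ)

  _⟶*_ : Term F → Term F → Set
  _⟶*_ = Star _⟶_

  ⟶-sub : ∀ σ → _⟶_ =[ sub σ ]⇒ _⟶_
  ⟶-sub = Ctx-sub λ σ → Sum.map (BetaRoot-sub σ) (RRoot-sub σ)

  ⟶*-sub : ∀ σ → _⟶*_ =[ sub σ ]⇒ _⟶*_
  ⟶*-sub σ = gmap (sub σ) (⟶-sub σ)

  ⟶ᴿ*-sub : ∀ σ → Star (Ctx (RRoot ℛ)) =[ sub σ ]⇒ _⟶*_
  ⟶ᴿ*-sub σ = gmap (sub σ) (⟶-sub σ ∘ Ctx-map inj₂)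

  ⟶*-ren : ∀ ρ → _⟶*_ =[ ren ρ ]⇒ _⟶*_
  ⟶*-ren ρ {t} {u} = subst₂ _⟶*_ (sym (ren-as-sub ρ t)) (sym (ren-as-sub ρ u)) ∘ ⟶*-sub (var ∘ ρ)

  extS-⟶* : ∀ {σ σ′ : Subst} → (∀ x → σ x ⟶* σ′ x) → ∀ x → extS σ x ⟶* extS σ′ x
  extS-⟶* σ⟶*σ′ zero    = ε
  extS-⟶* σ⟶*σ′ (suc x) = ⟶*-ren suc (σ⟶*σ′ x)

  sub-⟶* : ∀ {σ σ′ : Subst} → (∀ x → σ x ⟶* σ′ x) → ∀ t → sub σ t ⟶* sub σ′ t
  sub-⟶* σ⟶*σ′ (sort s)  = ε
  sub-⟶* σ⟶*σ′ (var x)   = σ⟶*σ′ x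
  sub-⟶* σ⟶*σ′ (fun f)   = ε
  sub-⟶* {σ} {σ′} σ⟶*σ′ (lam T u) =
    gmap (λ T′ → lam T′ (sub (extS σ) u)) lam₁ (sub-⟶* σ⟶*σ′ T) ◅◅
    gmap (lam (sub σ′ T)) lam₂ (sub-⟶* (extS-⟶* σ⟶*σ′) u)
  sub-⟶* {σ} {σ′} σ⟶*σ′ (pi T U) =
    gmap (λ T′ → pi T′ (sub (extS σ) U)) pi₁ (sub-⟶* σ⟶*σ′ T) ◅◅
    gmap (pi (sub σ′ T)) pi₂ (sub-⟶* (extS-⟶* σ⟶*σ′) U)
  sub-⟶* {σ} {σ′} σ⟶*σ′ (app t u) =
    gmap (λ t′ → app t′ (sub σ u)) app₁ (sub-⟶* σ⟶*σ′ t) ◅◅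
    gmap (app (sub σ′ t)) app₂ (sub-⟶* σ⟶*σ′ u)

  update-⟶* : ∀ {σ k s} → σ k ⟶ s → ∀ j → σ j ⟶* update σ k s j
  update-⟶* {k = k} σk⟶s j with j ℕ.≟ k
  ... | yes refl = σk⟶s ◅ ε
  ... | no _     = ε

  mixed-⟶* : ∀ {σ σ′ a v} → (∀ x → σ x ⟶* σ′ x) → MixedInstance σ σ′ a v → v ⟶* sub σ′ a
  mixed-⟶* σ⟶*σ′ (left refl)  = σ⟶*σ′ _
  mixed-⟶* σ⟶*σ′ (right refl) = ε
  mixed-⟶* σ⟶*σ′ (fun f)      = ε
  mixed-⟶* {σ′ = σ′} σ⟶*σ′ (app {a} m m′) =
    gmap (λ b′ → app b′ _) app₁ (mixed-⟶* σ⟶*σ′ m) ◅◅ gmap (app (sub σ′ a)) app₂ (mixed-⟶* σ⟶*σ′ m′)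

  ⟶⇔Step : _⟶_ ⇔ Step ℛ
  ⟶⇔Step = [ βstep , Rstep ]′ ∘ Ctx-∪ , λ { (βstep s) → Ctx-map inj₁ s ; (Rstep s) → Ctx-map inj₂ s }

  module _ (_≟ᶠ_ : DecidableEquality F) (wf : WellFormedRules ℛ) where

    open Capping _≟ᶠ_

    RRoot-FunHeaded : ∀ {t u} → RRoot ℛ t u → FunHeaded t
    RRoot-FunHeaded (inst σ l→r) with wf l→r
    ... | alg-var _ , l-not-var , _ = ⊥-elim (l-not-var tt)
    ... | alg-head l , _ , _        = AlgApp-FunHeaded l σ

    -- The rule applies to the cap because cap commutes with instantiating an algebraic term; the
    -- contractum is restored correctly because the variables of r occur in l.
    RRoot-cap : ∀ {L t u} → sub (restore L) (cap L t) ≡ t → RRoot ℛ t u →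
                ∃ λ a → RRoot ℛ (cap L t) a × sub (restore L) a ≡ u
    RRoot-cap {L} restores (inst {l} {r} σ l→r) =
      sub (cap L ∘ σ) r , subst (λ c → RRoot ℛ c _) (sym (cap-sub L σ l-alg)) (inst (cap L ∘ σ) l→r) , restores-r
      where
      open ≡-Reasoning
      θ = restore L
      l-alg = proj₁ (wf l→r)
      restores-l : sub (sub θ ∘ cap L ∘ σ) l ≡ sub σ l
      restores-l = begin
        sub (sub θ ∘ cap L ∘ σ) l  ≡⟨ sym (sub-sub θ (cap L ∘ σ) l) ⟩
        sub θ (sub (cap L ∘ σ) l)  ≡⟨ cong (sub θ) (sym (cap-sub L σ l-alg)) ⟩
        sub θ (cap L (sub σ l))    ≡⟨ restores ⟩
        sub σ l                    ∎
      restores-r : sub θ (sub (cap L ∘ σ) r) ≡ sub σ r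
      restores-r = trans (sub-sub θ (cap L ∘ σ) r) (sub-cong-FV r λ x x∈r →
        sub-agree-on-FV l-alg restores-l (proj₂ (proj₂ (wf l→r)) x x∈r))

    -- A step inside one occurrence of an alien θ x leaves the other occurrences unreduced.
    data CappedStep (θ : Subst) (c v : Term F) : Set where
      skeleton : ∀ {a} → c ⟶[ ℛ ] a → sub θ a ≡ v → CappedStep θ c v
      alien    : ∀ {θ′} → (∀ x → θ x ⟶* θ′ x) → MixedInstance θ θ′ c v → CappedStep θ c v

    alien-step : ∀ {θ k t v} → θ k ≡ t → t ⟶ v → CappedStep θ (var k) v
    alien-step {θ} {k} refl step = alien (update-⟶* step) (right (update-same θ k _))

    CappedStep-app₁ : ∀ {θ c d v u} → Algebraic d → sub θ d ≡ u →
                      CappedStep θ c v → CappedStep θ (app c d) (app v u)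
    CappedStep-app₁ d refl (skeleton s refl) = skeleton (app₁ s) refl
    CappedStep-app₁ d refl (alien θ⟶*θ′ m)   = alien θ⟶*θ′ (app m (mixed-refl d))

    CappedStep-app₂ : ∀ {θ c d v t} → AlgApp c → sub θ c ≡ t →
                      CappedStep θ d v → CappedStep θ (app c d) (app t v)
    CappedStep-app₂ c refl (skeleton s refl) = skeleton (app₂ s) refl
    CappedStep-app₂ c refl (alien θ⟶*θ′ m)   = alien θ⟶*θ′ (app (AlgApp-mixed-refl c) m)

    capped-step : ∀ {L t v} → sub (restore L) (cap L t) ≡ t → t ⟶ v → CappedStep (restore L) (cap L t) v
    capped-step restores (root (inj₁ β@(beta _ _ _))) = alien-step restores (root (inj₁ β))
    capped-step restores (root (inj₂ r)) =
      let a , r′ , restores-a = RRoot-cap restores r in skeleton (root r′) restores-a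
    capped-step restores (lam₁ s) = alien-step restores (lam₁ s)
    capped-step restores (lam₂ s) = alien-step restores (lam₂ s)
    capped-step restores (pi₁ s)  = alien-step restores (pi₁ s)
    capped-step restores (pi₂ s)  = alien-step restores (pi₂ s)
    capped-step {L} {app t u} restores (app₁ s) with funHeaded? t
    ... | yes _      = CappedStep-app₁ (cap-algebraic L u) (app-injectiveʳ restores)
                         (capped-step (app-injectiveˡ restores) s)
    ... | no _       = alien-step restores (app₁ s)
    capped-step {L} {app t u} restores (app₂ s) with funHeaded? t
    ... | yes t-head = CappedStep-app₂ (cap-AlgApp L t-head) (app-injectiveˡ restores)
                         (capped-step (app-injectiveʳ restores) s)
    ... | no _       = alien-step restores (app₂ s)

    R-root-peak : LocallyConfluentOn Algebraic (λ t u → t ⟶[ ℛ ] u) →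
                  ∀ {t u v} → RRoot ℛ t u → t ⟶ v → Joinable _⟶_ u v
    R-root-peak lcA {t} r s
      with RRoot-cap (restore-cap t id) r | capped-step (restore-cap t id) s
    ... | a , r′ , refl | skeleton s′ refl =
      let w , p , q = lcA (cap-algebraic (aliens t) t) (root r′) s′
      in sub (restore (aliens t)) w , ⟶ᴿ*-sub _ p , ⟶ᴿ*-sub _ q
    ... | a , r′ , refl | alien {θ′} θ⟶*θ′ m =
      sub θ′ a , sub-⟶* θ⟶*θ′ a , mixed-⟶* θ⟶*θ′ m ◅◅ root (inj₂ (RRoot-sub θ′ r′)) ◅ ε

    β-root-peak : ∀ {t u v} → BetaRoot t u → t ⟶ v → Joinable _⟶_ u v
    β-root-peak (beta T b w) (root (inj₁ (beta _ _ _))) = _ , ε , ε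
    β-root-peak (beta T b w) (root (inj₂ r)) with app () ← RRoot-FunHeaded r
    β-root-peak (beta T b w) (app₁ (root (inj₁ ())))
    β-root-peak (beta T b w) (app₁ (root (inj₂ r))) with () ← RRoot-FunHeaded r
    β-root-peak (beta T b w) (app₁ (lam₁ _)) = b [ w ] , ε , root (inj₁ (beta _ b w)) ◅ ε
    β-root-peak (beta T b w) (app₁ (lam₂ s)) = _ , ⟶-sub (single w) s ◅ ε , root (inj₁ (beta T _ w)) ◅ ε
    β-root-peak (beta T b w) (app₂ s) =
      _ , sub-⟶* (λ { zero → s ◅ ε ; (suc x) → ε }) b , root (inj₁ (beta T b _)) ◅ ε

    ⟶-locallyConfluent : LocallyConfluentOn Algebraic (λ t u → t ⟶[ ℛ ] u) → LocallyConfluent _⟶_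
    ⟶-locallyConfluent lcA = Ctx-locallyConfluent λ where
      (inj₁ b) → β-root-peak b
      (inj₂ r) → R-root-peak lcA r

mainTheorem1 : (F : Set) → Countable F → (ℛ : RuleSet {F}) → WellFormedRules ℛ →
    LocallyConfluentOn Algebraic (λ t u → t ⟶[ ℛ ] u) →
    LocallyConfluent (Step ℛ)
mainTheorem1 F (code , code-injective) ℛ wf lcA =
  locallyConfluent-⇔ (⟶⇔Step ℛ) (⟶-locallyConfluent ℛ _≟ᶠ_ wf lcA)
  where
  _≟ᶠ_ : DecidableEquality F
  _≟ᶠ_ = eq? (mk↣ code-injective)
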